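{- There is a constant $C_0>1$ such that for each $r\in\{0,1,2,3,4\}$ there are sequences of integers $(a_{j,r})_{j=0}^\infty$ and $(b_{j,r})_{j=0}^\infty$ such that for all $j\ge 0$: $a_{j,r}\equiv r \pmod 5$; $b_{j,r}\equiv 2r\pmod 5$; $\phi^{20j}/C_0<|a_{j,r}|<C_0\phi^{20j}$; $\phi^{20j}/C_0<|b_{j,r}|<C_0\phi^{20j}$; and $$\frac{1}{C_0|a_{j,r}|}<a_{j,r}\phi+b_{j,r}<\frac{C_0}{|a_{j,r}|}.$$
   Context: $\phi=\frac{1+\sqrt5}{2}$ is the golden ratio. -}

module Defs where

open import Data.Rational as ℚ using (ℚ; 0ℚ; 1ℚ; _≟_; ≢-nonZero)
import Data.Rational.Properties as ℚP
open import Data.Integer as ℤ using (ℤ)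
open import Data.Nat as ℕ using (ℕ; zero; suc)
open import Data.Product using (_×_; _,_)
open import Data.Sum using (_⊎_)
open import Relation.Nullary using (yes; no)

-- Elements of the real subfield ℚ(φ), φ = (1+√5)/2, written as  re + im·φ
-- with re, im ∈ ℚ.  This representation is unique since φ is irrational.
record Qφ : Set where
  constructor _+_φ
  field
    re : ℚ
    im : ℚ
open Qφ public

infixl 6 _⊕_ _⊖_
infixl 7 _⊗_

_⊕_ : Qφ → Qφ → Qφ
(a + b φ) ⊕ (c + d φ) = (a ℚ.+ c) + (b ℚ.+ d) φ

⊝_ : Qφ → Qφ
⊝ (a + b φ) = (ℚ.- a) + (ℚ.- b) φ

_⊖_ : Qφ → Qφ → Qφ
x ⊖ y = x ⊕ (⊝ y)

-- multiplication, using φ² = φ + 1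
_⊗_ : Qφ → Qφ → Qφ
(a + b φ) ⊗ (c + d φ) = (a ℚ.* c ℚ.+ b ℚ.* d) + (a ℚ.* d ℚ.+ b ℚ.* c ℚ.+ b ℚ.* d) φ

fromℚ : ℚ → Qφ
fromℚ q = q + 0ℚ φ

fromℤ : ℤ → Qφ
fromℤ z = fromℚ (z ℚ./ 1)

φ : Qφ
φ = 0ℚ + 1ℚ φ

_^_ : Qφ → ℕ → Qφ
x ^ zero  = fromℚ 1ℚ
x ^ suc n = x ⊗ (x ^ n)

-- total rational reciprocal (convention 1/0 = 0; never used at 0 in a
-- way that matters)
inv : ℚ → ℚ
inv q with q ≟ 0ℚ
... | yes _  = 0ℚ
... | no q≢0 = ℚ.1/_ q {{≢-nonZero q≢0}}

-- Positivity of the real number u + v·√5 (u, v ∈ ℚ), by exact case analysis.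
PosSqrt5 : ℚ → ℚ → Set
PosSqrt5 u v =
    (0ℚ ℚ.≤ u × 0ℚ ℚ.≤ v × (0ℚ ℚ.< u ⊎ 0ℚ ℚ.< v))
  ⊎ (0ℚ ℚ.< u × v ℚ.< 0ℚ × (ℤ.+ 5 ℚ./ 1) ℚ.* (v ℚ.* v) ℚ.< u ℚ.* u)
  ⊎ (u ℚ.< 0ℚ × 0ℚ ℚ.< v × u ℚ.* u ℚ.< (ℤ.+ 5 ℚ./ 1) ℚ.* (v ℚ.* v))

-- x > 0 as a real number.  p + qφ = ((2p+q) + q√5)/2.
Positive : Qφ → Set
Positive (p + q φ) = PosSqrt5 ((ℤ.+ 2 ℚ./ 1) ℚ.* p ℚ.+ q) q

infix 4 _<φ_
_<φ_ : Qφ → Qφ → Set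
x <φ y = Positive (y ⊖ x)

-- Write φ²⁰ʲ = G j + F j φ; then (G j, F j) = (F₂₀ⱼ₋₁, F₂₀ⱼ) are Fibonacci numbers, G j ≡ 1 and
-- F j ≡ 0 (mod 5), and Cassini's identity reads G² + GF − F² = 1.  For each residue r fix a
-- multiplier p + qφ with p ≡ r, q ≡ −2r (mod 5) and norm m = p² + pq − q² ∈ [1, 45], and let
-- A + Bφ = (p + qφ)φ²⁰ʲ, a = A, b = −B.  Then a ≡ r and b ≡ 2r (mod 5), A and B are comparable
-- to φ²⁰ʲ, and multiplicativity of the norm gives A² + AB − B² = m.  With w = 2B − A this says
-- w² + 4m = 5A², so aφ + b = (A√5 − w)/2 = 2m/(A√5 + w) lies between 1/(100A) and 100/A.
-- Every comparison in ℚ(φ) is reduced to the sign of U + V√5 with U, V integers, which is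
-- decided by comparing U² with 5V² in ℕ.

module Submission where

open import Defs
open import Data.Product using (Σ; ∃-syntax; _×_; _,_)
open import Relation.Binary.PropositionalEquality

-- Arithmetic in ℕ

module _ where
  open import Data.Bool.Base using (T)
  open import Data.List using (_∷_; [])
  open import Data.Nat hiding (_^_)
  open import Data.Nat.Properties
  open import Data.Nat.Tactic.RingSolver using (solve; solve-∀)

  ≤-compute : ∀ {m n} {_ : T (m ≤ᵇ n)} → m ≤ n
  ≤-compute {m} {n} {m≤ᵇn} = ≤ᵇ⇒≤ m n m≤ᵇn

  m*m≤n*n⇒m≤n : ∀ {m n} → m * m ≤ n * n → m ≤ n
  m*m≤n*n⇒m≤n m²≤n² = ≮⇒≥ λ n<m → <⇒≱ (*-mono-< n<m n<m) m²≤n²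

  3m<n⇒5m²<n² : ∀ {m n} → 3 * m < n → 5 * (m * m) < n * n
  3m<n⇒5m²<n² {m} {n} 3m<n = begin-strict
    5 * (m * m)                         ≤⟨ m≤m+n (5 * (m * m)) (4 * (m * m) + 6 * m) ⟩
    5 * (m * m) + (4 * (m * m) + 6 * m) <⟨ n<1+n _ ⟩
    suc (5 * (m * m) + (4 * (m * m) + 6 * m)) ≡⟨ solve (m ∷ []) ⟩
    suc (3 * m) * suc (3 * m)           ≤⟨ *-mono-≤ 3m<n 3m<n ⟩
    n * n                               ∎
    where open ≤-Reasoning

  -- (a + bφ)(x + yφ) = (ax + by) + (bx + (a + b)y)φ
  ≡1+0φ[mod5]-⊗ : ∀ {a b x y} → ∃[ c ] a ≡ 1 + 5 * c → ∃[ d ] b ≡ 5 * d →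
                  (∃[ g ] x ≡ 1 + 5 * g) × (∃[ f ] y ≡ 5 * f) →
                  (∃[ g ] a * x + b * y ≡ 1 + 5 * g) × (∃[ f ] b * x + (a + b) * y ≡ 5 * f)
  ≡1+0φ[mod5]-⊗ (c , refl) (d , refl) ((g , refl) , (f , refl)) =
      (c + g + 5 * (c * g) + 5 * (d * f) , re-part c d g f)
    , (d + f + 5 * (c * f) + 5 * (d * g) + 5 * (d * f) , im-part c d g f)
    where
    re-part : ∀ c d g f → (1 + 5 * c) * (1 + 5 * g) + 5 * d * (5 * f)
                          ≡ 1 + 5 * (c + g + 5 * (c * g) + 5 * (d * f))
    re-part = solve-∀
    im-part : ∀ c d g f → 5 * d * (1 + 5 * g) + (1 + 5 * c + 5 * d) * (5 * f)
                          ≡ 5 * (d + f + 5 * (c * f) + 5 * (d * g) + 5 * (d * f))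
    im-part = solve-∀

  -- (p + qφ)(x + yφ) = A + Bφ, and x² + xy − y² is the norm of x + yφ.
  norm-multiplicative : ∀ p q m x y → p * p + p * q ≡ q * q + m → x * x + x * y ≡ y * y + 1 →
    let A = p * x + q * y
        B = q * x + (p + q) * y
    in A * A + A * B ≡ B * B + m
  norm-multiplicative p q m x y N[p+qφ] N[x+yφ] = +-cancelʳ-≡ (common (q * q) (y * y) m) _ _ (begin
    A * A + A * B + common (q * q) (y * y) m
      ≡⟨ regroupˡ (A * A + A * B) (q * q) (y * y) m ⟩
    A * A + A * B + (q * q + m) * (y * y) + q * q * (y * y + 1)
      ≡⟨ cong₂ (λ s t → A * A + A * B + s * (y * y) + q * q * t) (sym N[p+qφ]) (sym N[x+yφ]) ⟩
    A * A + A * B + (p * p + p * q) * (y * y) + q * q * (x * x + x * y)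
      ≡⟨ form-identity p q x y ⟩
    B * B + (p * p + p * q) * (x * x + x * y) + q * q * (y * y)
      ≡⟨ cong₂ (λ s t → B * B + s * t + q * q * (y * y)) N[p+qφ] N[x+yφ] ⟩
    B * B + (q * q + m) * (y * y + 1) + q * q * (y * y)
      ≡⟨ regroupʳ (B * B) (q * q) (y * y) m ⟩
    B * B + m + common (q * q) (y * y) m
      ∎)
    where
    open ≡-Reasoning
    A = p * x + q * y
    B = q * x + (p + q) * y
    common : ℕ → ℕ → ℕ → ℕ
    common Q Y m = m * Y + 2 * (Q * Y) + Q
    regroupˡ : ∀ s Q Y m → s + (m * Y + 2 * (Q * Y) + Q) ≡ s + (Q + m) * Y + Q * (Y + 1)
    regroupˡ = solve-∀
    regroupʳ : ∀ s Q Y m → s + (Q + m) * (Y + 1) + Q * Y ≡ s + m + (m * Y + 2 * (Q * Y) + Q)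
    regroupʳ = solve-∀
    form-identity : ∀ p q x y →
      let A = p * x + q * y
          B = q * x + (p + q) * y
      in A * A + A * B + (p * p + p * q) * (y * y) + q * q * (x * x + x * y)
         ≡ B * B + (p * p + p * q) * (x * x + x * y) + q * q * (y * y)
    form-identity = solve-∀

  -- φ²⁰ = 4181 + 6765φ; the recursion multiplies G j + F j φ by it.
  G F : ℕ → ℕ
  G zero    = 1
  G (suc j) = 4181 * G j + 6765 * F j
  F zero    = 0
  F (suc j) = 6765 * G j + (4181 + 6765) * F j

  G≡1∧F≡0[mod5] : ∀ j → (∃[ g ] G j ≡ 1 + 5 * g) × (∃[ f ] F j ≡ 5 * f)
  G≡1∧F≡0[mod5] zero    = (0 , refl) , (0 , refl)
  G≡1∧F≡0[mod5] (suc j) = ≡1+0φ[mod5]-⊗ (836 , refl) (1353 , refl) (G≡1∧F≡0[mod5] j)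

  1≤G : ∀ j → 1 ≤ G j
  1≤G j with G≡1∧F≡0[mod5] j
  ... | (g , G≡) , _ = subst (1 ≤_) (sym G≡) (s≤s z≤n)

  cassini : ∀ j → G j * G j + G j * F j ≡ F j * F j + 1
  cassini zero    = refl
  cassini (suc j) = norm-multiplicative 4181 6765 1 (G j) (F j) refl (cassini j)

  norm⇒discriminant : ∀ {A B m w} → w + A ≡ 2 * B → A * A + A * B ≡ B * B + m →
                      w * w + 4 * m ≡ 5 * (A * A)
  norm⇒discriminant {A} {B} {m} {w} w+A≡2B N[A+Bφ] = +-cancelʳ-≡ (A * A + 2 * (w * A)) _ _ (begin
    w * w + 4 * m + (A * A + 2 * (w * A))  ≡⟨ solve (A ∷ m ∷ w ∷ []) ⟩
    (w + A) * (w + A) + 4 * m              ≡⟨ cong (λ t → t * t + 4 * m) w+A≡2B ⟩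
    2 * B * (2 * B) + 4 * m                ≡⟨ solve (B ∷ m ∷ []) ⟩
    4 * (B * B + m)                        ≡⟨ cong (4 *_) N[A+Bφ] ⟨
    4 * (A * A + A * B)                    ≡⟨ solve (A ∷ B ∷ []) ⟩
    4 * (A * A) + 2 * A * (2 * B)          ≡⟨ cong (λ t → 4 * (A * A) + 2 * A * t) w+A≡2B ⟨
    4 * (A * A) + 2 * A * (w + A)          ≡⟨ solve (A ∷ w ∷ []) ⟩
    5 * (A * A) + (A * A + 2 * (w * A))    ∎)
    where open ≡-Reasoning

  discriminant⇒w≤3A : ∀ {A m w} → w * w + 4 * m ≡ 5 * (A * A) → w ≤ 3 * A
  discriminant⇒w≤3A {A} {m} {w} disc = m*m≤n*n⇒m≤n (begin
    w * w               ≤⟨ m≤m+n (w * w) (4 * m) ⟩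
    w * w + 4 * m       ≡⟨ disc ⟩
    5 * (A * A)         ≤⟨ m≤m+n (5 * (A * A)) (4 * (A * A)) ⟩
    5 * (A * A) + 4 * (A * A) ≡⟨ solve (A ∷ []) ⟩
    3 * A * (3 * A)     ∎)
    where open ≤-Reasoning

  discriminant⇒1+w<100A : ∀ {A m w} → w * w + 4 * m ≡ 5 * (A * A) → 1 ≤ A → suc w < 100 * A
  discriminant⇒1+w<100A {A} {m} {w} disc 1≤A = begin
    suc (suc w)        ≤⟨ s≤s (s≤s (discriminant⇒w≤3A {A} {m} disc)) ⟩
    suc (suc (3 * A))  ≡⟨ solve (A ∷ []) ⟩
    3 * A + 2 * 1      ≤⟨ +-monoʳ-≤ (3 * A) (*-monoʳ-≤ 2 1≤A) ⟩
    3 * A + 2 * A      ≡⟨ solve (A ∷ []) ⟩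
    5 * A              ≤⟨ *-monoˡ-≤ A (≤-compute {5} {100}) ⟩
    100 * A            ∎
    where open ≤-Reasoning

  [wt+2]²<5[At]² : ∀ {A m w t} → w * w + 4 * m ≡ 5 * (A * A) → 1 ≤ m → suc w < t →
                   (w * t + 2) * (w * t + 2) < 5 * ((A * t) * (A * t))
  [wt+2]²<5[At]² {A} {m} {w} {t} disc 1≤m 1+w<t = begin-strict
    (w * t + 2) * (w * t + 2)            ≡⟨ solve (w ∷ t ∷ []) ⟩
    w * w * (t * t) + 4 * (w * t + 1)    <⟨ +-monoʳ-< (w * w * (t * t)) (*-monoʳ-< 4 wt+1<mt²) ⟩
    w * w * (t * t) + 4 * (m * (t * t))  ≡⟨ solve (m ∷ w ∷ t ∷ []) ⟩
    (w * w + 4 * m) * (t * t)            ≡⟨ cong (_* (t * t)) disc ⟩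
    5 * (A * A) * (t * t)                ≡⟨ solve (A ∷ t ∷ []) ⟩
    5 * ((A * t) * (A * t))              ∎
    where
    open ≤-Reasoning
    1≤t : 1 ≤ t
    1≤t = ≤-trans (s≤s z≤n) (<⇒≤ 1+w<t)
    wt+1<mt² : w * t + 1 < m * (t * t)
    wt+1<mt² = begin-strict
      w * t + 1   ≤⟨ +-monoʳ-≤ (w * t) 1≤t ⟩
      w * t + t   ≡⟨ +-comm (w * t) t ⟩
      suc w * t   <⟨ *-monoˡ-< t {{>-nonZero 1≤t}} 1+w<t ⟩
      t * t       ≤⟨ m≤n*m (t * t) m {{>-nonZero 1≤m}} ⟩
      m * (t * t) ∎

  5[AA]²<[wA+200]² : ∀ {A m w} → w * w + 4 * m ≡ 5 * (A * A) → m ≤ 45 →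
                     5 * ((A * A) * (A * A)) < (w * A + 200) * (w * A + 200)
  5[AA]²<[wA+200]² {A} {m} {w} disc m≤45 = begin-strict
    5 * ((A * A) * (A * A))                  ≡⟨ solve (A ∷ []) ⟩
    A * A * (5 * (A * A))                    ≡⟨ cong (A * A *_) disc ⟨
    A * A * (w * w + 4 * m)                  ≡⟨ solve (A ∷ m ∷ w ∷ []) ⟩
    w * w * (A * A) + 4 * m * (A * A)        <⟨ +-monoʳ-< (w * w * (A * A)) 4mA²<400wA+40000 ⟩
    w * w * (A * A) + (400 * (w * A) + 40000) ≡⟨ solve (A ∷ w ∷ []) ⟩
    (w * A + 200) * (w * A + 200)            ∎
    where
    open ≤-Reasoning
    4mA²<400wA+40000 : 4 * m * (A * A) < 400 * (w * A) + 40000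
    4mA²<400wA+40000 = begin-strict
      4 * m * (A * A)              ≤⟨ *-monoˡ-≤ (A * A) (*-monoʳ-≤ 4 m≤45) ⟩
      180 * (A * A)                ≡⟨ solve (A ∷ []) ⟩
      36 * (5 * (A * A))           ≡⟨ cong (36 *_) disc ⟨
      36 * (w * w + 4 * m)
        ≤⟨ *-monoʳ-≤ 36 (+-mono-≤ (*-monoʳ-≤ w (discriminant⇒w≤3A {A} {m} disc)) (*-monoʳ-≤ 4 m≤45)) ⟩
      36 * (w * (3 * A) + 180)
        ≡⟨ solve (A ∷ w ∷ []) ⟩
      108 * (w * A) + 6480
        <⟨ +-mono-≤-< (*-monoˡ-≤ (w * A) (≤-compute {108} {400})) (≤-compute {6481} {40000}) ⟩
      400 * (w * A) + 40000
        ∎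

  1+3y+[2x+y]≤200n : ∀ {x y n} → 1 ≤ x → x + y ≤ n → suc (3 * y) + (2 * x + y) ≤ 200 * n
  1+3y+[2x+y]≤200n {x} {y} {n} 1≤x x+y≤n = begin
    suc (3 * y) + (2 * x + y)                 ≡⟨ solve (x ∷ y ∷ []) ⟩
    1 + (2 * x + 4 * y)                       ≤⟨ +-monoˡ-≤ (2 * x + 4 * y) 1≤x ⟩
    x + (2 * x + 4 * y)                       ≤⟨ m≤m+n (x + (2 * x + 4 * y)) (197 * x + 196 * y) ⟩
    x + (2 * x + 4 * y) + (197 * x + 196 * y) ≡⟨ solve (x ∷ y ∷ []) ⟩
    200 * (x + y)                             ≤⟨ *-monoʳ-≤ 200 x+y≤n ⟩
    200 * n                                   ∎
    where open ≤-Reasoning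

  2n<200x+100y : ∀ {x y n} → 1 ≤ x → n ≤ 50 * (x + y) → 2 * n < 200 * x + 100 * y
  2n<200x+100y {x} {y} {n} 1≤x n≤50[x+y] = begin-strict
    2 * n                ≤⟨ *-monoʳ-≤ 2 n≤50[x+y] ⟩
    2 * (50 * (x + y))   ≡⟨ solve (x ∷ y ∷ []) ⟩
    100 * x + 100 * y    <⟨ +-monoˡ-< (100 * y) (*-monoˡ-< x {{>-nonZero 1≤x}} (≤-compute {101} {200})) ⟩
    200 * x + 100 * y    ∎
    where open ≤-Reasoning

-- Embeddings, positivity and estimates in ℚ(φ)

module _ where
  open import Level using (0ℓ)
  open import Data.Nat as ℕ using (ℕ; zero; suc; z≤n; s≤s)
  import Data.Nat.Properties as ℕP
  open import Data.Integer as ℤ using (+_)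
  import Data.Integer.Properties as ℤP
  open import Data.Rational
    using (ℚ; 0ℚ; 1ℚ; _+_; _*_; -_; _-_; _<_; _≤_; _/_; _≟_; toℚᵘ; positive; nonNegative; ≢-nonZero)
  open import Data.Rational.Properties
  import Data.Rational.Unnormalised as ℚᵘ
  import Data.Rational.Unnormalised.Properties as ℚᵘP
  open import Data.Sum using (inj₁; inj₂)
  open import Relation.Nullary using (yes; no; contradiction)
  open import Relation.Nullary.Decidable.Core using (dec⇒maybe)
  open import Tactic.RingSolver.Core.AlmostCommutativeRing using (AlmostCommutativeRing; fromCommutativeRing)
  open import Tactic.RingSolver using (solve-∀)

  ℚ-ring : AlmostCommutativeRing 0ℓ 0ℓ
  ℚ-ring = fromCommutativeRing +-*-commutativeRing (λ q → dec⇒maybe (0ℚ ≟ q))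

  ι : ℕ → ℚ
  ι n = + n / 1

  private
    ι≃ : ∀ n → toℚᵘ (ι n) ℚᵘ.≃ ℚᵘ.mkℚᵘ (+ n) 0
    ι≃ n = toℚᵘ-fromℚᵘ (ℚᵘ.mkℚᵘ (+ n) 0)

  ι-+ : ∀ m n → ι (m ℕ.+ n) ≡ ι m + ι n
  ι-+ m n = toℚᵘ-injective (begin-equality
    toℚᵘ (ι (m ℕ.+ n))                   ≃⟨ ι≃ (m ℕ.+ n) ⟩
    ℚᵘ.mkℚᵘ (+ (m ℕ.+ n)) 0              ≃⟨ ℚᵘ.*≡* (cong (ℤ._* + 1) pos-+) ⟩
    ℚᵘ.mkℚᵘ (+ m) 0 ℚᵘ.+ ℚᵘ.mkℚᵘ (+ n) 0 ≃⟨ ℚᵘP.+-cong (ι≃ m) (ι≃ n) ⟨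
    toℚᵘ (ι m) ℚᵘ.+ toℚᵘ (ι n)           ≃⟨ toℚᵘ-homo-+ (ι m) (ι n) ⟨
    toℚᵘ (ι m + ι n)                     ∎)
    where
    open ℚᵘP.≤-Reasoning
    pos-+ : + (m ℕ.+ n) ≡ + m ℤ.* + 1 ℤ.+ + n ℤ.* + 1
    pos-+ = trans (ℤP.pos-+ m n) (sym (cong₂ ℤ._+_ (ℤP.*-identityʳ (+ m)) (ℤP.*-identityʳ (+ n))))

  ι-* : ∀ m n → ι (m ℕ.* n) ≡ ι m * ι n
  ι-* m n = toℚᵘ-injective (begin-equality
    toℚᵘ (ι (m ℕ.* n))                   ≃⟨ ι≃ (m ℕ.* n) ⟩
    ℚᵘ.mkℚᵘ (+ (m ℕ.* n)) 0              ≃⟨ ℚᵘ.*≡* (cong (ℤ._* + 1) (ℤP.pos-* m n)) ⟩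
    ℚᵘ.mkℚᵘ (+ m) 0 ℚᵘ.* ℚᵘ.mkℚᵘ (+ n) 0 ≃⟨ ℚᵘP.*-cong (ι≃ m) (ι≃ n) ⟨
    toℚᵘ (ι m) ℚᵘ.* toℚᵘ (ι n)           ≃⟨ toℚᵘ-homo-* (ι m) (ι n) ⟨
    toℚᵘ (ι m * ι n)                     ∎)
    where open ℚᵘP.≤-Reasoning

  ι-∸ : ∀ {m n} → n ℕ.≤ m → ι (m ℕ.∸ n) ≡ ι m - ι n
  ι-∸ {m} {n} n≤m = begin
    ι (m ℕ.∸ n)                  ≡⟨ add-sub (ι (m ℕ.∸ n)) (ι n) ⟩
    ι (m ℕ.∸ n) + ι n - ι n      ≡⟨ cong (_- ι n) (ι-+ (m ℕ.∸ n) n) ⟨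
    ι (m ℕ.∸ n ℕ.+ n) - ι n      ≡⟨ cong (λ k → ι k - ι n) (ℕP.m∸n+n≡m n≤m) ⟩
    ι m - ι n                    ∎
    where
    open ≡-Reasoning
    add-sub : ∀ x y → x ≡ x + y - y
    add-sub = solve-∀ ℚ-ring

  ι-*+* : ∀ a m b n → ι (a ℕ.* m ℕ.+ b ℕ.* n) ≡ ι a * ι m + ι b * ι n
  ι-*+* a m b n = trans (ι-+ (a ℕ.* m) (b ℕ.* n)) (cong₂ _+_ (ι-* a m) (ι-* b n))

  ι-neg : ∀ n → (ℤ.- (+ n)) / 1 ≡ - ι n
  ι-neg zero    = refl
  ι-neg (suc n) = refl

  ι-mono-≤ : ∀ {m n} → m ℕ.≤ n → ι m ≤ ι n
  ι-mono-≤ {m} {n} m≤n = toℚᵘ-cancel-≤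
    (ℚᵘP.≤-respʳ-≃ (ℚᵘP.≃-sym (ι≃ n)) (ℚᵘP.≤-respˡ-≃ (ℚᵘP.≃-sym (ι≃ m))
      (ℚᵘ.*≤* (ℤP.*-monoʳ-≤-nonNeg (+ 1) (ℤ.+≤+ m≤n)))))

  ι-mono-< : ∀ {m n} → m ℕ.< n → ι m < ι n
  ι-mono-< {m} {n} m<n = toℚᵘ-cancel-<
    (ℚᵘP.<-respʳ-≃ (ℚᵘP.≃-sym (ι≃ n)) (ℚᵘP.<-respˡ-≃ (ℚᵘP.≃-sym (ι≃ m))
      (ℚᵘ.*<* (ℤP.*-monoʳ-<-pos (+ 1) (ℤ.+<+ m<n)))))

  *-pos : ∀ {x y} → 0ℚ < x → 0ℚ < y → 0ℚ < x * y
  *-pos {x} {y} 0<x 0<y = positive⁻¹ (x * y) {{pos*pos⇒pos x {{positive 0<x}} y {{positive 0<y}}}}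

  ι*-pos : ∀ {n k} → 0 ℕ.< n → 0ℚ < k → 0ℚ < ι n * k
  ι*-pos 0<n = *-pos (ι-mono-< {0} 0<n)

  ι*-nonNeg : ∀ n {k} → 0ℚ < k → 0ℚ ≤ ι n * k
  ι*-nonNeg n {k} 0<k = nonNegative⁻¹ (ι n * k)
    {{nonNeg*nonNeg⇒nonNeg (ι n) {{nonNegative (ι-mono-≤ {0} {n} z≤n)}} k {{nonNegative (<⇒≤ 0<k)}}}}

  ι*-square : ∀ n k → (ι n * k) * (ι n * k) ≡ ι (n ℕ.* n) * (k * k)
  ι*-square n k = trans (regroup (ι n) k) (cong (_* (k * k)) (sym (ι-* n n)))
    where
    regroup : ∀ x k → (x * k) * (x * k) ≡ (x * x) * (k * k)
    regroup = solve-∀ ℚ-ring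

  five-ι*-square : ∀ n k → ι 5 * ((ι n * k) * (ι n * k)) ≡ ι (5 ℕ.* (n ℕ.* n)) * (k * k)
  five-ι*-square n k = begin
    ι 5 * ((ι n * k) * (ι n * k)) ≡⟨ cong (ι 5 *_) (ι*-square n k) ⟩
    ι 5 * (ι (n ℕ.* n) * (k * k)) ≡⟨ *-assoc (ι 5) (ι (n ℕ.* n)) (k * k) ⟨
    ι 5 * ι (n ℕ.* n) * (k * k)   ≡⟨ cong (_* (k * k)) (ι-* 5 (n ℕ.* n)) ⟨
    ι (5 ℕ.* (n ℕ.* n)) * (k * k) ∎
    where open ≡-Reasoning

  neg-square : ∀ x → - x * - x ≡ x * x
  neg-square = solve-∀ ℚ-ring

  ι*square-mono-< : ∀ {m n k} → 0ℚ < k → m ℕ.< n → ι m * (k * k) < ι n * (k * k)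
  ι*square-mono-< {k = k} 0<k m<n = *-monoˡ-<-pos (k * k) {{positive (*-pos 0<k 0<k)}} (ι-mono-< m<n)

  -- The superscripts are the signs of u and v.
  posSqrt5⁺⁺ : ∀ U V {k u v} → 0ℚ < k → 0 ℕ.< U → u ≡ ι U * k → v ≡ ι V * k → PosSqrt5 u v
  posSqrt5⁺⁺ U V 0<k 0<U refl refl =
    inj₁ (<⇒≤ (ι*-pos 0<U 0<k) , ι*-nonNeg V 0<k , inj₁ (ι*-pos 0<U 0<k))

  posSqrt5⁺⁻ : ∀ U V {k u v} → 0ℚ < k → 5 ℕ.* (V ℕ.* V) ℕ.< U ℕ.* U →
               u ≡ ι U * k → v ≡ - (ι V * k) → PosSqrt5 u v
  posSqrt5⁺⁻ zero      V         0<k ()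
  posSqrt5⁺⁻ U@(suc _) zero      {k} 0<k _ refl refl =
    posSqrt5⁺⁺ U zero 0<k (s≤s z≤n) refl (trans (cong -_ (*-zeroˡ k)) (sym (*-zeroˡ k)))
  posSqrt5⁺⁻ U@(suc _) V@(suc _) {k} 0<k 5V²<U² refl refl =
    inj₂ (inj₁ (ι*-pos {U} (s≤s z≤n) 0<k , neg-antimono-< (ι*-pos {V} (s≤s z≤n) 0<k) , 5v²<u²))
    where
    5v²<u² : ι 5 * (- (ι V * k) * - (ι V * k)) < (ι U * k) * (ι U * k)
    5v²<u² = subst₂ _<_
      (trans (sym (five-ι*-square V k)) (cong (ι 5 *_) (sym (neg-square (ι V * k)))))
      (sym (ι*-square U k))
      (ι*square-mono-< 0<k 5V²<U²)

  posSqrt5⁻⁺ : ∀ U V {k u v} → 0ℚ < k → U ℕ.* U ℕ.< 5 ℕ.* (V ℕ.* V) →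
               u ≡ - (ι U * k) → v ≡ ι V * k → PosSqrt5 u v
  posSqrt5⁻⁺ U         zero      0<k ()
  posSqrt5⁻⁺ zero      V@(suc _) {k} 0<k _ refl refl =
    inj₁ (≤-reflexive (sym (cong -_ (*-zeroˡ k))) , <⇒≤ 0<v , inj₂ 0<v)
    where
    0<v : 0ℚ < ι V * k
    0<v = ι*-pos {V} (s≤s z≤n) 0<k
  posSqrt5⁻⁺ U@(suc _) V@(suc _) {k} 0<k U²<5V² refl refl =
    inj₂ (inj₂ (neg-antimono-< (ι*-pos {U} (s≤s z≤n) 0<k) , ι*-pos {V} (s≤s z≤n) 0<k , u²<5v²))
    where
    u²<5v² : - (ι U * k) * - (ι U * k) < ι 5 * ((ι V * k) * (ι V * k))
    u²<5v² = subst₂ _<_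
      (trans (sym (ι*-square U k)) (sym (neg-square (ι U * k))))
      (sym (five-ι*-square V k))
      (ι*square-mono-< 0<k U²<5V²)

  ιφ : ℕ → ℕ → Qφ
  ιφ m n = _+_φ (ι m) (ι n)

  fromℚ-⊗ : ∀ c x → fromℚ c ⊗ x ≡ _+_φ (c * re x) (c * im x)
  fromℚ-⊗ c x = cong₂ _+_φ (re-part c (re x) (im x)) (im-part c (re x) (im x))
    where
    re-part : ∀ c a b → c * a + 0ℚ * b ≡ c * a
    re-part = solve-∀ ℚ-ring
    im-part : ∀ c a b → c * b + 0ℚ * a + 0ℚ * b ≡ c * b
    im-part = solve-∀ ℚ-ring

  fromℤ-⊗φ-⊕ : ∀ a b → fromℤ a ⊗ φ ⊕ fromℤ b ≡ _+_φ (b / 1) (a / 1)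
  fromℤ-⊗φ-⊕ a b = cong₂ _+_φ (re-part (a / 1) (b / 1)) (im-part (a / 1))
    where
    re-part : ∀ x y → x * 0ℚ + 0ℚ * 1ℚ + y ≡ y
    re-part = solve-∀ ℚ-ring
    im-part : ∀ x → x * 1ℚ + 0ℚ * 0ℚ + 0ℚ * 1ℚ + 0ℚ ≡ x
    im-part = solve-∀ ℚ-ring

  ⊗-assoc : ∀ x y z → (x ⊗ y) ⊗ z ≡ x ⊗ (y ⊗ z)
  ⊗-assoc x y z = cong₂ _+_φ (re-part (re x) (im x) (re y) (im y) (re z) (im z))
                             (im-part (re x) (im x) (re y) (im y) (re z) (im z))
    where
    re-part : ∀ a b c d e f →
      (a * c + b * d) * e + (a * d + b * c + b * d) * f ≡ a * (c * e + d * f) + b * (c * f + d * e + d * f)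
    re-part = solve-∀ ℚ-ring
    im-part : ∀ a b c d e f →
      (a * c + b * d) * f + (a * d + b * c + b * d) * e + (a * d + b * c + b * d) * f
        ≡ a * (c * f + d * e + d * f) + b * (c * e + d * f) + b * (c * f + d * e + d * f)
    im-part = solve-∀ ℚ-ring

  ⊗-identityˡ : ∀ x → fromℚ 1ℚ ⊗ x ≡ x
  ⊗-identityˡ x = trans (fromℚ-⊗ 1ℚ x) (cong₂ _+_φ (*-identityˡ (re x)) (*-identityˡ (im x)))

  ^-distribˡ-+-⊗ : ∀ x m n → x ^ (m ℕ.+ n) ≡ x ^ m ⊗ x ^ n
  ^-distribˡ-+-⊗ x zero    n = sym (⊗-identityˡ (x ^ n))
  ^-distribˡ-+-⊗ x (suc m) n = trans (cong (x ⊗_) (^-distribˡ-+-⊗ x m n)) (sym (⊗-assoc x (x ^ m) (x ^ n)))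

  φ²⁰ : φ ^ 20 ≡ ιφ 4181 6765
  φ²⁰ = refl

  -- The endpoints of the first step are given explicitly: inferring them would unfold φ ^ (20 * suc j).
  φ^[20j] : ∀ j → φ ^ (20 ℕ.* j) ≡ ιφ (G j) (F j)
  φ^[20j] zero    = refl
  φ^[20j] (suc j) = begin
    φ ^ (20 ℕ.* suc j)              ≡⟨ cong (φ ^_) {20 ℕ.* suc j} {20 ℕ.+ 20 ℕ.* j} (ℕP.*-suc 20 j) ⟩
    φ ^ (20 ℕ.+ 20 ℕ.* j)           ≡⟨ ^-distribˡ-+-⊗ φ 20 (20 ℕ.* j) ⟩
    φ ^ 20 ⊗ φ ^ (20 ℕ.* j)         ≡⟨ cong₂ _⊗_ φ²⁰ (φ^[20j] j) ⟩
    ιφ 4181 6765 ⊗ ιφ (G j) (F j)   ≡⟨ cong₂ _+_φ (sym G-step) (sym F-step) ⟩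
    ιφ (G (suc j)) (F (suc j))      ∎
    where
    open ≡-Reasoning
    G-step : ι (G (suc j)) ≡ ι 4181 * ι (G j) + ι 6765 * ι (F j)
    G-step = ι-*+* 4181 (G j) 6765 (F j)
    F-step : ι (F (suc j)) ≡ ι 4181 * ι (F j) + ι 6765 * ι (G j) + ι 6765 * ι (F j)
    F-step = begin
      ι (6765 ℕ.* G j ℕ.+ (4181 ℕ.+ 6765) ℕ.* F j)          ≡⟨ ι-*+* 6765 (G j) (4181 ℕ.+ 6765) (F j) ⟩
      ι 6765 * ι (G j) + ι (4181 ℕ.+ 6765) * ι (F j)        ≡⟨ cong (λ z → ι 6765 * ι (G j) + z * ι (F j)) (ι-+ 4181 6765) ⟩
      ι 6765 * ι (G j) + (ι 4181 + ι 6765) * ι (F j)        ≡⟨ regroup (ι 4181) (ι 6765) (ι (G j)) (ι (F j)) ⟩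
      ι 4181 * ι (F j) + ι 6765 * ι (G j) + ι 6765 * ι (F j) ∎
      where
      regroup : ∀ a b x y → b * x + (a + b) * y ≡ a * y + b * x + b * y
      regroup = solve-∀ ℚ-ring

  inv-inverseʳ : ∀ {q} → 0ℚ < q → q * inv q ≡ 1ℚ
  inv-inverseʳ {q} 0<q with q ≟ 0ℚ
  ... | yes q≡0 = contradiction (sym q≡0) (<⇒≢ 0<q)
  ... | no  q≢0 = *-inverseʳ q {{≢-nonZero q≢0}}

  inv-pos : ∀ {q} → 0ℚ < q → 0ℚ < inv q
  inv-pos {q} 0<q with q ≟ 0ℚ
  ... | yes q≡0 = contradiction (sym q≡0) (<⇒≢ 0<q)
  ... | no  q≢0 = positive⁻¹ _ {{1/pos⇒pos q {{positive 0<q}}}}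

  C₀ : ℚ
  C₀ = ι 100

  0<C₀ : 0ℚ < C₀
  0<C₀ = ι-mono-< {0} {100} (s≤s z≤n)

  1<C₀ : 1ℚ < C₀
  1<C₀ = ι-mono-< {1} {100} ≤-compute

  [x+yφ]/C₀<n : ∀ {x y n} → 1 ℕ.≤ x → x ℕ.+ y ℕ.≤ n → fromℚ (inv C₀) ⊗ ιφ x y <φ fromℤ (+ n)
  [x+yφ]/C₀<n {x} {y} {n} 1≤x x+y≤n =
    subst (_<φ fromℤ (+ n)) (sym (fromℚ-⊗ c (ιφ x y)))
      (posSqrt5⁺⁻ U y (inv-pos 0<C₀) (3m<n⇒5m²<n² {y} {U} 3y<U) u≡ v≡)
    where
    c = inv C₀
    U = 200 ℕ.* n ℕ.∸ (2 ℕ.* x ℕ.+ y)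
    bound : suc (3 ℕ.* y) ℕ.+ (2 ℕ.* x ℕ.+ y) ℕ.≤ 200 ℕ.* n
    bound = 1+3y+[2x+y]≤200n 1≤x x+y≤n
    3y<U : 3 ℕ.* y ℕ.< U
    3y<U = ℕP.m+n≤o⇒m≤o∸n (suc (3 ℕ.* y)) bound
    ι-U : ι U ≡ ι 200 * ι n - (ι 2 * ι x + ι y)
    ι-U = begin
      ι U                                ≡⟨ ι-∸ (ℕP.≤-trans (ℕP.m≤n+m _ (suc (3 ℕ.* y))) bound) ⟩
      ι (200 ℕ.* n) - ι (2 ℕ.* x ℕ.+ y)  ≡⟨ cong₂ _-_ (ι-* 200 n) (trans (ι-+ (2 ℕ.* x) y) (cong (_+ ι y) (ι-* 2 x))) ⟩
      ι 200 * ι n - (ι 2 * ι x + ι y)    ∎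
      where open ≡-Reasoning
    u≡ : ι 2 * (ι n - c * ι x) + (0ℚ - c * ι y) ≡ ι U * c
    u≡ = trans (identity (ι n) (ι x) (ι y)) (cong (_* c) (sym ι-U))
      where
      identity : ∀ n x y → ι 2 * (n - c * x) + (0ℚ - c * y) ≡ (ι 200 * n - (ι 2 * x + y)) * c
      identity = solve-∀ ℚ-ring
    v≡ : 0ℚ - c * ι y ≡ - (ι y * c)
    v≡ = identity (ι y)
      where
      identity : ∀ y → 0ℚ - c * y ≡ - (y * c)
      identity = solve-∀ ℚ-ring

  n<C₀[x+yφ] : ∀ {x y n} → 1 ℕ.≤ x → n ℕ.≤ 50 ℕ.* (x ℕ.+ y) → fromℤ (+ n) <φ fromℚ C₀ ⊗ ιφ x y
  n<C₀[x+yφ] {x} {y} {n} 1≤x n≤50[x+y] =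
    subst (fromℤ (+ n) <φ_) (sym (fromℚ-⊗ C₀ (ιφ x y)))
      (posSqrt5⁺⁺ U (100 ℕ.* y) (ι-mono-< {0} {1} (s≤s z≤n)) (ℕP.m<n⇒0<n∸m 2n<U′) u≡ v≡)
    where
    2n<U′ : 2 ℕ.* n ℕ.< 200 ℕ.* x ℕ.+ 100 ℕ.* y
    2n<U′ = 2n<200x+100y 1≤x n≤50[x+y]
    U = 200 ℕ.* x ℕ.+ 100 ℕ.* y ℕ.∸ 2 ℕ.* n
    ι-U : ι U ≡ ι 200 * ι x + ι 100 * ι y - ι 2 * ι n
    ι-U = trans (ι-∸ (ℕP.<⇒≤ 2n<U′)) (cong₂ _-_ (ι-*+* 200 x 100 y) (ι-* 2 n))
    u≡ : ι 2 * (C₀ * ι x - ι n) + (C₀ * ι y - 0ℚ) ≡ ι U * 1ℚ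
    u≡ = trans (identity (ι n) (ι x) (ι y)) (cong (_* 1ℚ) (sym ι-U))
      where
      identity : ∀ n x y → ι 2 * (C₀ * x - n) + (C₀ * y - 0ℚ) ≡ (ι 200 * x + ι 100 * y - ι 2 * n) * 1ℚ
      identity = solve-∀ ℚ-ring
    v≡ : C₀ * ι y - 0ℚ ≡ ι (100 ℕ.* y) * 1ℚ
    v≡ = trans (identity (ι y)) (cong (_* 1ℚ) (sym (ι-* 100 y)))
      where
      identity : ∀ y → C₀ * y - 0ℚ ≡ (ι 100 * y) * 1ℚ
      identity = solve-∀ ℚ-ring

  φ²⁰ʲ/C₀<n : ∀ j {n} → G j ℕ.+ F j ℕ.≤ n → fromℚ (inv C₀) ⊗ φ ^ (20 ℕ.* j) <φ fromℤ (+ n)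
  φ²⁰ʲ/C₀<n j {n} G+F≤n =
    subst (λ z → fromℚ (inv C₀) ⊗ z <φ fromℤ (+ n)) (sym (φ^[20j] j)) ([x+yφ]/C₀<n (1≤G j) G+F≤n)

  n<C₀φ²⁰ʲ : ∀ j {n} → n ℕ.≤ 50 ℕ.* (G j ℕ.+ F j) → fromℤ (+ n) <φ fromℚ C₀ ⊗ φ ^ (20 ℕ.* j)
  n<C₀φ²⁰ʲ j {n} n≤50[G+F] =
    subst (λ z → fromℤ (+ n) <φ fromℚ C₀ ⊗ z) (sym (φ^[20j] j)) (n<C₀[x+yφ] (1≤G j) n≤50[G+F])

  module _ {A B m : ℕ} (1≤A : 1 ℕ.≤ A) (A≤2B : A ℕ.≤ 2 ℕ.* B)
           (N[A+Bφ] : A ℕ.* A ℕ.+ A ℕ.* B ≡ B ℕ.* B ℕ.+ m) where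

    private
      w = 2 ℕ.* B ℕ.∸ A

      disc : w ℕ.* w ℕ.+ 4 ℕ.* m ≡ 5 ℕ.* (A ℕ.* A)
      disc = norm⇒discriminant {A} {B} {m} {w} (ℕP.m∸n+n≡m A≤2B) N[A+Bφ]

      ι-w : ι w ≡ ι 2 * ι B - ι A
      ι-w = trans (ι-∸ {2 ℕ.* B} {A} A≤2B) (cong (_- ι A) (ι-* 2 B))

      0<A : 0ℚ < ι A
      0<A = ι-mono-< {0} {A} 1≤A

    -- With c = 1/(100A):  2(Aφ − B − c) = A√5 − (w + 2c) = (A·100A)c√5 − (w·100A + 2)c.
    1/[C₀A]<Aφ-B : 1 ℕ.≤ m → fromℚ (inv (C₀ * ι A)) <φ fromℤ (+ A) ⊗ φ ⊕ fromℤ (ℤ.- (+ B))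
    1/[C₀A]<Aφ-B 1≤m =
      subst (fromℚ c <φ_) (sym (fromℤ-⊗φ-⊕ (+ A) (ℤ.- (+ B))))
        (posSqrt5⁻⁺ U V (inv-pos 0<C₀A) U²<5V² u≡ v≡)
      where
      0<C₀A : 0ℚ < C₀ * ι A
      0<C₀A = *-pos 0<C₀ 0<A
      c = inv (C₀ * ι A)
      U = w ℕ.* (100 ℕ.* A) ℕ.+ 2
      V = A ℕ.* (100 ℕ.* A)
      U²<5V² : U ℕ.* U ℕ.< 5 ℕ.* (V ℕ.* V)
      U²<5V² = [wt+2]²<5[At]² {A} {m} {w} disc 1≤m (discriminant⇒1+w<100A {A} {m} {w} disc 1≤A)
      ι-U : ι U ≡ (ι 2 * ι B - ι A) * (C₀ * ι A) + ι 2
      ι-U = trans (ι-+ (w ℕ.* (100 ℕ.* A)) 2)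
                  (cong (_+ ι 2) (trans (ι-* w (100 ℕ.* A)) (cong₂ _*_ ι-w (ι-* 100 A))))
      u≡ : ι 2 * ((ℤ.- (+ B)) / 1 - c) + (ι A - 0ℚ) ≡ - (ι U * c)
      u≡ = begin
        ι 2 * ((ℤ.- (+ B)) / 1 - c) + (ι A - 0ℚ)
          ≡⟨ cong (λ b → ι 2 * (b - c) + (ι A - 0ℚ)) (ι-neg B) ⟩
        ι 2 * (- ι B - c) + (ι A - 0ℚ)
          ≡⟨ regroup (ι A) (ι B) c ⟩
        (ι A - ι 2 * ι B) * 1ℚ - ι 2 * c
          ≡⟨ cong (λ z → (ι A - ι 2 * ι B) * z - ι 2 * c) (inv-inverseʳ 0<C₀A) ⟨
        (ι A - ι 2 * ι B) * ((C₀ * ι A) * c) - ι 2 * c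
          ≡⟨ regroup′ (ι A) (ι B) (C₀ * ι A) c ⟩
        - (((ι 2 * ι B - ι A) * (C₀ * ι A) + ι 2) * c)
          ≡⟨ cong (λ z → - (z * c)) ι-U ⟨
        - (ι U * c)
          ∎
        where
        open ≡-Reasoning
        regroup : ∀ a b c → ι 2 * (- b - c) + (a - 0ℚ) ≡ (a - ι 2 * b) * 1ℚ - ι 2 * c
        regroup = solve-∀ ℚ-ring
        regroup′ : ∀ a b s c → (a - ι 2 * b) * (s * c) - ι 2 * c ≡ - (((ι 2 * b - a) * s + ι 2) * c)
        regroup′ = solve-∀ ℚ-ring
      v≡ : ι A - 0ℚ ≡ ι V * c
      v≡ = begin
        ι A - 0ℚ                ≡⟨ regroup (ι A) ⟩
        ι A * 1ℚ                ≡⟨ cong (ι A *_) (inv-inverseʳ 0<C₀A) ⟨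
        ι A * ((C₀ * ι A) * c)  ≡⟨ *-assoc (ι A) (C₀ * ι A) c ⟨
        ι A * (C₀ * ι A) * c    ≡⟨ cong (_* c) (trans (ι-* A (100 ℕ.* A)) (cong (ι A *_) (ι-* 100 A))) ⟨
        ι V * c                 ∎
        where
        open ≡-Reasoning
        regroup : ∀ a → a - 0ℚ ≡ a * 1ℚ
        regroup = solve-∀ ℚ-ring

    -- With c = 1/A:  2(C₀c − (Aφ − B)) = (wA + 200)c − (A·A)c√5.
    Aφ-B<C₀/A : m ℕ.≤ 45 → fromℤ (+ A) ⊗ φ ⊕ fromℤ (ℤ.- (+ B)) <φ fromℚ (C₀ * inv (ι A))
    Aφ-B<C₀/A m≤45 =
      subst (_<φ fromℚ (C₀ * c)) (sym (fromℤ-⊗φ-⊕ (+ A) (ℤ.- (+ B))))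
        (posSqrt5⁺⁻ U V (inv-pos 0<A) 5V²<U² u≡ v≡)
      where
      c = inv (ι A)
      U = w ℕ.* A ℕ.+ 200
      V = A ℕ.* A
      5V²<U² : 5 ℕ.* (V ℕ.* V) ℕ.< U ℕ.* U
      5V²<U² = 5[AA]²<[wA+200]² {A} {m} {w} disc m≤45
      ι-U : ι U ≡ (ι 2 * ι B - ι A) * ι A + ι 200
      ι-U = trans (ι-+ (w ℕ.* A) 200) (cong (_+ ι 200) (trans (ι-* w A) (cong (_* ι A) ι-w)))
      u≡ : ι 2 * (C₀ * c - (ℤ.- (+ B)) / 1) + (0ℚ - ι A) ≡ ι U * c
      u≡ = begin
        ι 2 * (C₀ * c - (ℤ.- (+ B)) / 1) + (0ℚ - ι A)
          ≡⟨ cong (λ b → ι 2 * (C₀ * c - b) + (0ℚ - ι A)) (ι-neg B) ⟩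
        ι 2 * (C₀ * c - - ι B) + (0ℚ - ι A)
          ≡⟨ regroup (ι A) (ι B) c ⟩
        (ι 2 * ι B - ι A) * 1ℚ + ι 200 * c
          ≡⟨ cong (λ z → (ι 2 * ι B - ι A) * z + ι 200 * c) (inv-inverseʳ 0<A) ⟨
        (ι 2 * ι B - ι A) * (ι A * c) + ι 200 * c
          ≡⟨ regroup′ (ι A) (ι B) c ⟩
        ((ι 2 * ι B - ι A) * ι A + ι 200) * c
          ≡⟨ cong (_* c) ι-U ⟨
        ι U * c
          ∎
        where
        open ≡-Reasoning
        regroup : ∀ a b c → ι 2 * (C₀ * c - - b) + (0ℚ - a) ≡ (ι 2 * b - a) * 1ℚ + ι 200 * c
        regroup = solve-∀ ℚ-ring
        regroup′ : ∀ a b c → (ι 2 * b - a) * (a * c) + ι 200 * c ≡ ((ι 2 * b - a) * a + ι 200) * c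
        regroup′ = solve-∀ ℚ-ring
      v≡ : 0ℚ - ι A ≡ - (ι V * c)
      v≡ = begin
        0ℚ - ι A             ≡⟨ regroup (ι A) ⟩
        - (ι A * 1ℚ)         ≡⟨ cong (λ z → - (ι A * z)) (inv-inverseʳ 0<A) ⟨
        - (ι A * (ι A * c))  ≡⟨ cong -_ (*-assoc (ι A) (ι A) c) ⟨
        - (ι A * ι A * c)    ≡⟨ cong (λ z → - (z * c)) (ι-* A A) ⟨
        - (ι V * c)          ∎
        where
        open ≡-Reasoning
        regroup : ∀ a → 0ℚ - a ≡ - (a * 1ℚ)
        regroup = solve-∀ ℚ-ring

-- The approximants

module _ where
  open import Data.Fin using (Fin; toℕ; zero; suc)
  open import Data.Nat hiding (_^_)
  open import Data.Nat.Properties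
  open import Data.Nat.Tactic.RingSolver using (solve-∀)
  open import Data.Integer as ℤ using (ℤ; +_; ∣_∣)
  import Data.Integer.Properties as ℤP
  import Data.Integer.Tactic.RingSolver as ℤ-Solver
  open import Data.Integer.Divisibility using (_∣_; divides)
  import Data.Rational as ℚ

  5∣+m-+n : ∀ {m n} k → m ≡ n + 5 * k → + 5 ∣ + m ℤ.- + n
  5∣+m-+n {m} {n} k refl = divides k (begin
    ∣ + (n + 5 * k) ℤ.- + n ∣           ≡⟨ cong (λ x → ∣ x ℤ.- + n ∣) (ℤP.pos-+ n (5 * k)) ⟩
    ∣ + n ℤ.+ + (5 * k) ℤ.- + n ∣       ≡⟨ cong ∣_∣ (add-sub (+ n) (+ (5 * k))) ⟩
    5 * k                               ≡⟨ *-comm 5 k ⟩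
    k * 5                               ∎)
    where
    open ≡-Reasoning
    add-sub : ∀ x y → x ℤ.+ y ℤ.- x ≡ y
    add-sub = ℤ-Solver.solve-∀

  5∣-+m-+n : ∀ {m n} k → m + n ≡ 5 * k → + 5 ∣ ℤ.- (+ m) ℤ.- + n
  5∣-+m-+n {m} {n} k m+n≡5k = divides k (begin
    ∣ ℤ.- (+ m) ℤ.- + n ∣     ≡⟨ cong ∣_∣ (neg-add (+ m) (+ n)) ⟩
    ∣ ℤ.- (+ m ℤ.+ + n) ∣     ≡⟨ ℤP.∣-i∣≡∣i∣ (+ m ℤ.+ + n) ⟩
    ∣ + m ℤ.+ + n ∣           ≡⟨ cong ∣_∣ (ℤP.pos-+ m n) ⟨
    m + n                     ≡⟨ m+n≡5k ⟩
    5 * k                     ≡⟨ *-comm 5 k ⟩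
    k * 5                     ∎)
    where
    open ≡-Reasoning
    neg-add : ∀ x y → ℤ.- x ℤ.- y ≡ ℤ.- (x ℤ.+ y)
    neg-add = ℤ-Solver.solve-∀

  record Multiplier (r : ℕ) : Set where
    constructor mkMultiplier
    field
      p q m        : ℕ
      p≡r[mod5]    : ∃[ e ] p ≡ r + 5 * e
      q+2r≡0[mod5] : ∃[ e ] q + 2 * r ≡ 5 * e
      norm         : p * p + p * q ≡ q * q + m
      1≤p          : 1 ≤ p
      1≤q          : 1 ≤ q
      p≤2q         : p ≤ 2 * q
      p+q≤50       : p + q ≤ 50
      1≤m          : 1 ≤ m
      m≤45         : m ≤ 45

  Approximants : ℕ → (ℕ → ℤ) → (ℕ → ℤ) → ℕ → Set
  Approximants r a b j =
      (+ 5 ∣ (a j ℤ.- + r))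
    × (+ 5 ∣ (b j ℤ.- + (2 * r)))
    × (fromℚ (inv C₀) ⊗ (φ ^ (20 * j)) <φ fromℤ (+ ∣ a j ∣))
    × (fromℤ (+ ∣ a j ∣) <φ fromℚ C₀ ⊗ (φ ^ (20 * j)))
    × (fromℚ (inv C₀) ⊗ (φ ^ (20 * j)) <φ fromℤ (+ ∣ b j ∣))
    × (fromℤ (+ ∣ b j ∣) <φ fromℚ C₀ ⊗ (φ ^ (20 * j)))
    × (fromℚ (inv (C₀ ℚ.* (+ ∣ a j ∣ ℚ./ 1))) <φ fromℤ (a j) ⊗ φ ⊕ fromℤ (b j))
    × (fromℤ (a j) ⊗ φ ⊕ fromℤ (b j) <φ fromℚ (C₀ ℚ.* inv (+ ∣ a j ∣ ℚ./ 1)))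

  module _ {r : ℕ} (μ : Multiplier r) where
    open Multiplier μ

    A B : ℕ → ℕ
    A j = p * G j + q * F j
    B j = q * G j + (p + q) * F j

    5∣A-r : ∀ j → + 5 ∣ + A j ℤ.- + r
    5∣A-r j with G≡1∧F≡0[mod5] j | p≡r[mod5]
    ... | (g , G≡) , (f , F≡) | (e , p≡) = 5∣+m-+n {A j} {r} (e + (p * g + q * f)) (begin
      p * G j + q * F j                 ≡⟨ cong₂ (λ x y → p * x + q * y) G≡ F≡ ⟩
      p * (1 + 5 * g) + q * (5 * f)     ≡⟨ expand p q g f ⟩
      p + 5 * (p * g + q * f)           ≡⟨ cong (_+ 5 * (p * g + q * f)) p≡ ⟩
      r + 5 * e + 5 * (p * g + q * f)   ≡⟨ regroup r e (p * g + q * f) ⟩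
      r + 5 * (e + (p * g + q * f))     ∎)
      where
      open ≡-Reasoning
      expand : ∀ p q g f → p * (1 + 5 * g) + q * (5 * f) ≡ p + 5 * (p * g + q * f)
      expand = solve-∀
      regroup : ∀ r e s → r + 5 * e + 5 * s ≡ r + 5 * (e + s)
      regroup = solve-∀

    5∣-B-2r : ∀ j → + 5 ∣ ℤ.- (+ B j) ℤ.- + (2 * r)
    5∣-B-2r j with G≡1∧F≡0[mod5] j | q+2r≡0[mod5]
    ... | (g , G≡) , (f , F≡) | (e , q+2r≡) = 5∣-+m-+n {B j} {2 * r} (e + (q * g + (p + q) * f)) (begin
      q * G j + (p + q) * F j + 2 * r              ≡⟨ cong₂ (λ x y → q * x + (p + q) * y + 2 * r) G≡ F≡ ⟩
      q * (1 + 5 * g) + (p + q) * (5 * f) + 2 * r  ≡⟨ expand p q g f r ⟩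
      q + 2 * r + 5 * (q * g + (p + q) * f)        ≡⟨ cong (_+ 5 * (q * g + (p + q) * f)) q+2r≡ ⟩
      5 * e + 5 * (q * g + (p + q) * f)            ≡⟨ *-distribˡ-+ 5 e (q * g + (p + q) * f) ⟨
      5 * (e + (q * g + (p + q) * f))              ∎)
      where
      open ≡-Reasoning
      expand : ∀ p q g f r → q * (1 + 5 * g) + (p + q) * (5 * f) + 2 * r ≡ q + 2 * r + 5 * (q * g + (p + q) * f)
      expand = solve-∀

    G+F≤A : ∀ j → G j + F j ≤ A j
    G+F≤A j = +-mono-≤ (m≤n*m (G j) p {{>-nonZero 1≤p}}) (m≤n*m (F j) q {{>-nonZero 1≤q}})

    G+F≤B : ∀ j → G j + F j ≤ B j
    G+F≤B j = +-mono-≤ (m≤n*m (G j) q {{>-nonZero 1≤q}})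
                       (m≤n*m (F j) (p + q) {{>-nonZero (≤-trans 1≤q (m≤n+m q p))}})

    ≤50[G+F] : ∀ j {x y} → x ≤ p + q → y ≤ p + q → x * G j + y * F j ≤ 50 * (G j + F j)
    ≤50[G+F] j {x} {y} x≤p+q y≤p+q = begin
      x * G j + y * F j
        ≤⟨ +-mono-≤ (*-monoˡ-≤ (G j) (≤-trans x≤p+q p+q≤50)) (*-monoˡ-≤ (F j) (≤-trans y≤p+q p+q≤50)) ⟩
      50 * G j + 50 * F j
        ≡⟨ *-distribˡ-+ 50 (G j) (F j) ⟨
      50 * (G j + F j)
        ∎
      where open ≤-Reasoning

    A≤2B : ∀ j → A j ≤ 2 * B j
    A≤2B j = begin
      p * G j + q * F j
        ≤⟨ +-mono-≤ (*-monoˡ-≤ (G j) p≤2q) (*-monoˡ-≤ (F j) (m≤n*m q 2)) ⟩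
      2 * q * G j + 2 * q * F j
        ≤⟨ +-monoʳ-≤ (2 * q * G j) (*-monoˡ-≤ (F j) (*-monoʳ-≤ 2 (m≤n+m q p))) ⟩
      2 * q * G j + 2 * (p + q) * F j
        ≡⟨ regroup q (p + q) (G j) (F j) ⟩
      2 * (q * G j + (p + q) * F j)
        ∎
      where
      open ≤-Reasoning
      regroup : ∀ q s x y → 2 * q * x + 2 * s * y ≡ 2 * (q * x + s * y)
      regroup = solve-∀

    1≤A : ∀ j → 1 ≤ A j
    1≤A j = ≤-trans (1≤G j) (≤-trans (m≤m+n (G j) (F j)) (G+F≤A j))

    N[A+Bφ] : ∀ j → A j * A j + A j * B j ≡ B j * B j + m
    N[A+Bφ] j = norm-multiplicative p q m (G j) (F j) norm (cassini j)

    approximants : Σ (ℕ → ℤ) λ a → Σ (ℕ → ℤ) λ b → ∀ j → Approximants r a b j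
    approximants = (λ j → + A j) , (λ j → ℤ.- (+ B j)) , λ j →
        5∣A-r j
      , 5∣-B-2r j
      , φ²⁰ʲ/C₀<n j (G+F≤A j)
      , n<C₀φ²⁰ʲ j (≤50[G+F] j (m≤m+n p q) (m≤n+m q p))
      , φ²⁰ʲ/C₀<n j (subst (G j + F j ≤_) (sym (ℤP.∣-i∣≡∣i∣ (+ B j))) (G+F≤B j))
      , n<C₀φ²⁰ʲ j (subst (_≤ 50 * (G j + F j)) (sym (ℤP.∣-i∣≡∣i∣ (+ B j))) (≤50[G+F] j (m≤n+m q p) ≤-refl))
      , 1/[C₀A]<Aφ-B (1≤A j) (A≤2B j) (N[A+Bφ] j) 1≤m
      , Aφ-B<C₀/A (1≤A j) (A≤2B j) (N[A+Bφ] j) m≤45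

  multiplier : (r : Fin 5) → Multiplier (toℕ r)
  multiplier zero =
    mkMultiplier 5 5 25 (1 , refl) (1 , refl) refl ≤-compute ≤-compute ≤-compute ≤-compute ≤-compute ≤-compute
  multiplier (suc zero) =
    mkMultiplier 6 3 45 (1 , refl) (1 , refl) refl ≤-compute ≤-compute ≤-compute ≤-compute ≤-compute ≤-compute
  multiplier (suc (suc zero)) =
    mkMultiplier 2 1 5 (0 , refl) (1 , refl) refl ≤-compute ≤-compute ≤-compute ≤-compute ≤-compute ≤-compute
  multiplier (suc (suc (suc zero))) =
    mkMultiplier 3 4 5 (0 , refl) (2 , refl) refl ≤-compute ≤-compute ≤-compute ≤-compute ≤-compute ≤-compute
  multiplier (suc (suc (suc (suc zero)))) =
    mkMultiplier 4 2 20 (0 , refl) (2 , refl) refl ≤-compute ≤-compute ≤-compute ≤-compute ≤-compute ≤-compute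

open import Data.Rational using (ℚ; 1ℚ; _<_; _*_)
open import Data.Integer using (ℤ; +_; ∣_∣; _-_)
open import Data.Integer.Divisibility using (_∣_)
open import Data.Nat using (ℕ)
open import Data.Fin using (Fin; toℕ)
open import Data.Product using (Σ; _×_)

lemma4p1 : Σ ℚ λ C₀ → 1ℚ < C₀ ×
    ((r : Fin 5) → Σ (ℕ → ℤ) λ a → Σ (ℕ → ℤ) λ b → (j : ℕ) →
        (+ 5 ∣ (a j - + toℕ r))
      × (+ 5 ∣ (b j - + (2 Data.Nat.* toℕ r)))
      × (fromℚ (inv C₀) ⊗ (φ ^ (20 Data.Nat.* j)) <φ fromℤ (+ ∣ a j ∣))
      × (fromℤ (+ ∣ a j ∣) <φ fromℚ C₀ ⊗ (φ ^ (20 Data.Nat.* j)))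
      × (fromℚ (inv C₀) ⊗ (φ ^ (20 Data.Nat.* j)) <φ fromℤ (+ ∣ b j ∣))
      × (fromℤ (+ ∣ b j ∣) <φ fromℚ C₀ ⊗ (φ ^ (20 Data.Nat.* j)))
      × (fromℚ (inv (C₀ * (+ ∣ a j ∣ Data.Rational./ 1))) <φ fromℤ (a j) ⊗ φ ⊕ fromℤ (b j))
      × (fromℤ (a j) ⊗ φ ⊕ fromℤ (b j) <φ fromℚ (C₀ * inv (+ ∣ a j ∣ Data.Rational./ 1))))
lemma4p1 = C₀ , 1<C₀ , λ r → approximants (multiplier r)
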